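{- Fix a type $\tau$. For any formula $C$, predicate $B: lst\to o$, term $L: lst$, finite multiset $\Gamma$ of formulas, and eigenvariables $x:\tau$ and $l: lst$ not free in $B$, the inference rule $$\frac{\longrightarrow B\,nil\qquad B\,l\longrightarrow B\,(x::l)\qquad B\,L,\Gamma\longrightarrow C}{list\,L,\Gamma\longrightarrow C}$$ is derivable in $FO\lambda^{\Delta\mathbb{N}}$ using the definition $\mathcal{D}_{list}(\tau)$, i.e. there is a derivation of the conclusion whose only unproved leaves are instances of the three premises.
   Context: $FO\lambda^{\Delta\mathbb{N}}$ is the following intuitionistic sequent calculus. Terms are simply typed $\lambda$-terms (up to $\alpha\beta\eta$-conversion) over a signature of typed constants; $o$ is the type of formulas, and quantifiers range only over types not containing $o$. Formulas are built from atomic formulas with $\bot,\top,\land,\lor,\supset,\forall,\exists$. There is a type $nt$ with constants $z:nt$, $s:nt\to nt$ and a predicate $nat: nt\to o$. Sequents are $\Gamma\longrightarrow B$, $\Gamma$ a finite multiset. Rules: $\bot,\Gamma\longrightarrow B$ and $\Gamma\longrightarrow\top$ are axioms; the usual intuitionistic left and right rules for $\land,\lor,\supset,\forall,\exists$ (with the usual eigenvariable conditions); initial sequents $A,\Gamma\longrightarrow A$ for atomic $A$; left contraction; cut. For $nat$: $\Gamma\longrightarrow nat\,z$; from $\Gamma\longrightarrow nat\,I$ infer $\Gamma\longrightarrow nat\,(s\,I)$; induction: for $B:nt\to o$ and eigenvariable $j$ not free in $B$, from $\longrightarrow B\,z$, $B\,j\longrightarrow B\,(s\,j)$, $B\,I,\Gamma\longrightarrow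 C$ infer $nat\,I,\Gamma\longrightarrow C$. Relative to a definition (set of clauses $\forall\bar x[p\,\bar t\triangleq B]$, free variables of $B$ occurring in $\bar t$, satisfying a level condition): right rule: from $\Gamma\longrightarrow B\theta$ infer $\Gamma\longrightarrow p\,\bar u$ when $p\,\bar u=(p\,\bar t)\theta$; left rule: infer $p\,\bar u,\Gamma\longrightarrow C$ from the premises $B\theta,\Gamma\theta\longrightarrow C\theta$ for every clause (renamed apart) and every $\theta$ in a complete set of unifiers of $p\,\bar u$ and $p\,\bar t$. For a fixed type $\tau$, $lst$ is a type with constants $nil: lst$ and infix $::\,:\tau\to lst\to lst$. $\mathcal{D}_{list}(\tau)$ is the definition with predicates $length: lst\to nt\to o$, $list: lst\to o$, $element:\tau\to lst\to o$, $split: lst\to lst\to lst\to o$, $permute: lst\to lst\to o$ and clauses: $length\,nil\,z\triangleq\top$; $length\,(X::L)\,(s\,I)\triangleq length\,L\,I$; $list\,L\triangleq\exists i(nat\,i\land length\,L\,i)$; $element\,X\,(X::L)\triangleq\top$; $element\,X\,(Y::L)\triangleq element\,X\,L$; $split\,nil\,nil\,nil\triangleq\top$; $split\,(X::L_1)\,(X::L_2)\,L_3\triangleq split\,L_1\,L_2\,L_3$; $split\,(X::L_1)\,L_2\,(X::L_3)\triangleq split\,L_1\,L_2\,L_3$; $permute\,nil\,nil\triangleq\top$; $permute\,(X::L_1)\,L_2\triangleq\exists l_{22}(split\,L_2\,(X::nil)\,l_{22}\land permute\,L_1\,l_{22})$. -}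

module Defs where

open import Data.Nat using (ℕ)
open import Data.List using (List; []; _∷_; map)
open import Data.Product using (Σ; _×_; _,_)
open import Relation.Binary.PropositionalEquality using (_≡_)
open import Data.List.Relation.Binary.Permutation.Propositional using (_↭_)

-- Simple types.  Types of terms never contain o: formulas are a
-- separate syntactic category (see Fm below), and o only occurs as the
-- result type of predicates / logical constants.

infixr 30 _⇒_
data Ty : Set where
  base : ℕ → Ty          -- further base types of the signature
  nt   : Ty
  lst  : Ty
  _⇒_  : Ty → Ty → Ty

Ctx : Set
Ctx = List Ty

data _∋_ {A : Set} : List A → A → Set where
  here  : ∀ {x xs} → (x ∷ xs) ∋ x
  there : ∀ {x y xs} → xs ∋ x → (y ∷ xs) ∋ x

Ren : Ctx → Ctx → Set
Ren Δ Δ' = ∀ {σ} → Δ ∋ σ → Δ' ∋ σ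

ext : ∀ {Δ Δ' ρ} → Ren Δ Δ' → Ren (ρ ∷ Δ) (ρ ∷ Δ')
ext r here      = here
ext r (there v) = there (r v)

-- The calculus, parametrised by the element type τ of lists, a
-- signature Sig of further (term) constants and a signature PSig of
-- further (undefined) predicate constants, given by their argument types.

module FOλ (τ : Ty) (Sig : List Ty) (PSig : List (List Ty)) where

  data Const : Ty → Set where
    zC    : Const nt
    sC    : Const (nt ⇒ nt)
    nilC  : Const lst
    consC : Const (τ ⇒ lst ⇒ lst)
    ucon  : ∀ {σ} → Sig ∋ σ → Const σ

  data Tm (Δ : Ctx) : Ty → Set where
    var : ∀ {σ} → Δ ∋ σ → Tm Δ σ
    cst : ∀ {σ} → Const σ → Tm Δ σ
    lam : ∀ {σ ρ} → Tm (σ ∷ Δ) ρ → Tm Δ (σ ⇒ ρ)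
    app : ∀ {σ ρ} → Tm Δ (σ ⇒ ρ) → Tm Δ σ → Tm Δ ρ

  zT : ∀ {Δ} → Tm Δ nt
  zT = cst zC

  sT : ∀ {Δ} → Tm Δ nt → Tm Δ nt
  sT i = app (cst sC) i

  nilT : ∀ {Δ} → Tm Δ lst
  nilT = cst nilC

  infixr 25 _::_
  _::_ : ∀ {Δ} → Tm Δ τ → Tm Δ lst → Tm Δ lst
  x :: l = app (app (cst consC) x) l

  ren : ∀ {Δ Δ' σ} → Ren Δ Δ' → Tm Δ σ → Tm Δ' σ
  ren r (var v)   = var (r v)
  ren r (cst c)   = cst c
  ren r (lam t)   = lam (ren (ext r) t)
  ren r (app t u) = app (ren r t) (ren r u)

  Sub : Ctx → Ctx → Set
  Sub Δ Δ' = ∀ {σ} → Δ ∋ σ → Tm Δ' σ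

  exts : ∀ {Δ Δ' ρ} → Sub Δ Δ' → Sub (ρ ∷ Δ) (ρ ∷ Δ')
  exts s here      = var here
  exts s (there v) = ren there (s v)

  sub : ∀ {Δ Δ' σ} → Sub Δ Δ' → Tm Δ σ → Tm Δ' σ
  sub s (var v)   = s v
  sub s (cst c)   = cst c
  sub s (lam t)   = lam (sub (exts s) t)
  sub s (app t u) = app (sub s t) (sub s u)

  sub1 : ∀ {Δ σ} → Tm Δ σ → Sub (σ ∷ Δ) Δ
  sub1 u here      = u
  sub1 u (there v) = var v

  -- αβη-conversion (α is built in by de Bruijn indices)
  infix 4 _≈_
  data _≈_ {Δ : Ctx} : ∀ {σ} → Tm Δ σ → Tm Δ σ → Set where
    ≈refl  : ∀ {σ} {t : Tm Δ σ} → t ≈ t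
    ≈sym   : ∀ {σ} {t u : Tm Δ σ} → t ≈ u → u ≈ t
    ≈trans : ∀ {σ} {t u v : Tm Δ σ} → t ≈ u → u ≈ v → t ≈ v
    ≈lam   : ∀ {σ ρ} {t u : Tm (σ ∷ Δ) ρ} → t ≈ u → lam t ≈ lam u
    ≈app   : ∀ {σ ρ} {t t' : Tm Δ (σ ⇒ ρ)} {u u' : Tm Δ σ} →
             t ≈ t' → u ≈ u' → app t u ≈ app t' u'
    ≈β     : ∀ {σ ρ} (t : Tm (σ ∷ Δ) ρ) (u : Tm Δ σ) →
             app (lam t) u ≈ sub (sub1 u) t
    ≈η     : ∀ {σ ρ} (t : Tm Δ (σ ⇒ ρ)) →
             t ≈ lam (app (ren there t) (var here))

  infixr 5 _∷ₐ_
  data Args (Δ : Ctx) : List Ty → Set where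
    []ₐ  : Args Δ []
    _∷ₐ_ : ∀ {σ as} → Tm Δ σ → Args Δ as → Args Δ (σ ∷ as)

  subA : ∀ {Δ Δ' as} → Sub Δ Δ' → Args Δ as → Args Δ' as
  subA s []ₐ       = []ₐ
  subA s (t ∷ₐ ts) = sub s t ∷ₐ subA s ts

  renA : ∀ {Δ Δ' as} → Ren Δ Δ' → Args Δ as → Args Δ' as
  renA r []ₐ       = []ₐ
  renA r (t ∷ₐ ts) = ren r t ∷ₐ renA r ts

  data _≈ₐ_ {Δ : Ctx} : ∀ {as} → Args Δ as → Args Δ as → Set where
    []≈ : []ₐ ≈ₐ []ₐ
    ∷≈  : ∀ {σ as} {t u : Tm Δ σ} {ts us : Args Δ as} →
          t ≈ u → ts ≈ₐ us → (t ∷ₐ ts) ≈ₐ (u ∷ₐ us)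

  data Pred : Set where
    nat length list element split permute : Pred
    upred : ∀ {as} → PSig ∋ as → Pred

  arity : Pred → List Ty
  arity nat       = nt ∷ []
  arity length    = lst ∷ nt ∷ []
  arity list      = lst ∷ []
  arity element   = τ ∷ lst ∷ []
  arity split     = lst ∷ lst ∷ lst ∷ []
  arity permute   = lst ∷ lst ∷ []
  arity (upred {as} _) = as

  data Defined : Pred → Set where
    dlength  : Defined length
    dlist    : Defined list
    delement : Defined element
    dsplit   : Defined split
    dpermute : Defined permute

  infixr 6 _∧_
  infixr 5 _∨_
  infixr 4 _⊃_
  data Fm (Δ : Ctx) : Set where
    atom : (p : Pred) → Args Δ (arity p) → Fm Δ
    ⊥′ ⊤′ : Fm Δ
    _∧_ _∨_ _⊃_ : Fm Δ → Fm Δ → Fm Δ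
    all ex : (σ : Ty) → Fm (σ ∷ Δ) → Fm Δ

  renF : ∀ {Δ Δ'} → Ren Δ Δ' → Fm Δ → Fm Δ'
  renF r (atom p ts) = atom p (renA r ts)
  renF r ⊥′ = ⊥′
  renF r ⊤′ = ⊤′
  renF r (A ∧ B) = renF r A ∧ renF r B
  renF r (A ∨ B) = renF r A ∨ renF r B
  renF r (A ⊃ B) = renF r A ⊃ renF r B
  renF r (all σ A) = all σ (renF (ext r) A)
  renF r (ex σ A)  = ex σ (renF (ext r) A)

  subF : ∀ {Δ Δ'} → Sub Δ Δ' → Fm Δ → Fm Δ'
  subF s (atom p ts) = atom p (subA s ts)
  subF s ⊥′ = ⊥′
  subF s ⊤′ = ⊤′
  subF s (A ∧ B) = subF s A ∧ subF s B
  subF s (A ∨ B) = subF s A ∨ subF s B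
  subF s (A ⊃ B) = subF s A ⊃ subF s B
  subF s (all σ A) = all σ (subF (exts s) A)
  subF s (ex σ A)  = ex σ (subF (exts s) A)

  -- B t  for  B : σ → o  (represented as a formula with one extra variable)
  _⟪_⟫ : ∀ {Δ σ} → Fm (σ ∷ Δ) → Tm Δ σ → Fm Δ
  B ⟪ t ⟫ = subF (sub1 t) B

  infix 4 _≈F_
  data _≈F_ {Δ : Ctx} : Fm Δ → Fm Δ → Set where
    atom≈ : ∀ p {ts us : Args Δ (arity p)} → ts ≈ₐ us → atom p ts ≈F atom p us
    ⊥≈ : ⊥′ ≈F ⊥′
    ⊤≈ : ⊤′ ≈F ⊤′
    ∧≈ : ∀ {A A' B B'} → A ≈F A' → B ≈F B' → (A ∧ B) ≈F (A' ∧ B')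
    ∨≈ : ∀ {A A' B B'} → A ≈F A' → B ≈F B' → (A ∨ B) ≈F (A' ∨ B')
    ⊃≈ : ∀ {A A' B B'} → A ≈F A' → B ≈F B' → (A ⊃ B) ≈F (A' ⊃ B')
    all≈ : ∀ {σ} {A A' : Fm (σ ∷ Δ)} → A ≈F A' → all σ A ≈F all σ A'
    ex≈  : ∀ {σ} {A A' : Fm (σ ∷ Δ)} → A ≈F A' → ex σ A ≈F ex σ A'

  data _≈L_ {Δ : Ctx} : List (Fm Δ) → List (Fm Δ) → Set where
    []≈ : [] ≈L []
    ∷≈  : ∀ {A B Γ Γ'} → A ≈F B → Γ ≈L Γ' → (A ∷ Γ) ≈L (B ∷ Γ')

  data Clause : Set where
    cLenNil cLenCons cList cElemHere cElemThere
      cSplitNil cSplitL cSplitR cPermNil cPermCons : Clause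

  -- clause variables (the ∀x̄ of the clause)
  cctx : Clause → Ctx
  cctx cLenNil    = []
  cctx cLenCons   = τ ∷ lst ∷ nt ∷ []          -- X L I
  cctx cList      = lst ∷ []                   -- L
  cctx cElemHere  = τ ∷ lst ∷ []               -- X L
  cctx cElemThere = τ ∷ τ ∷ lst ∷ []           -- X Y L
  cctx cSplitNil  = []
  cctx cSplitL    = τ ∷ lst ∷ lst ∷ lst ∷ []   -- X L1 L2 L3
  cctx cSplitR    = τ ∷ lst ∷ lst ∷ lst ∷ []   -- X L1 L2 L3
  cctx cPermNil   = []
  cctx cPermCons  = τ ∷ lst ∷ lst ∷ []         -- X L1 L2

  private
    v0 : ∀ {σ Δ} → Tm (σ ∷ Δ) σ
    v0 = var here
    v1 : ∀ {σ ρ Δ} → Tm (ρ ∷ σ ∷ Δ) σ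
    v1 = var (there here)
    v2 : ∀ {σ ρ ρ' Δ} → Tm (ρ' ∷ ρ ∷ σ ∷ Δ) σ
    v2 = var (there (there here))
    v3 : ∀ {σ ρ ρ' ρ'' Δ} → Tm (ρ'' ∷ ρ' ∷ ρ ∷ σ ∷ Δ) σ
    v3 = var (there (there (there here)))

  chead : (c : Clause) → Fm (cctx c)
  chead cLenNil    = atom length (nilT ∷ₐ zT ∷ₐ []ₐ)
  chead cLenCons   = atom length ((v0 :: v1) ∷ₐ sT v2 ∷ₐ []ₐ)
  chead cList      = atom list (v0 ∷ₐ []ₐ)
  chead cElemHere  = atom element (v0 ∷ₐ (v0 :: v1) ∷ₐ []ₐ)
  chead cElemThere = atom element (v0 ∷ₐ (v1 :: v2) ∷ₐ []ₐ)
  chead cSplitNil  = atom split (nilT ∷ₐ nilT ∷ₐ nilT ∷ₐ []ₐ)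
  chead cSplitL    = atom split ((v0 :: v1) ∷ₐ (v0 :: v2) ∷ₐ v3 ∷ₐ []ₐ)
  chead cSplitR    = atom split ((v0 :: v1) ∷ₐ v2 ∷ₐ (v0 :: v3) ∷ₐ []ₐ)
  chead cPermNil   = atom permute (nilT ∷ₐ nilT ∷ₐ []ₐ)
  chead cPermCons  = atom permute ((v0 :: v1) ∷ₐ v2 ∷ₐ []ₐ)

  cbody : (c : Clause) → Fm (cctx c)
  cbody cLenNil    = ⊤′
  cbody cLenCons   = atom length (v1 ∷ₐ v2 ∷ₐ []ₐ)
  cbody cList      = ex nt (atom nat (v0 ∷ₐ []ₐ) ∧ atom length (v1 ∷ₐ v0 ∷ₐ []ₐ))
  cbody cElemHere  = ⊤′
  cbody cElemThere = atom element (v0 ∷ₐ v2 ∷ₐ []ₐ)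
  cbody cSplitNil  = ⊤′
  cbody cSplitL    = atom split (v1 ∷ₐ v2 ∷ₐ v3 ∷ₐ []ₐ)
  cbody cSplitR    = atom split (v1 ∷ₐ v2 ∷ₐ v3 ∷ₐ []ₐ)
  cbody cPermNil   = ⊤′
  -- ∃ l22 (split L2 (X::nil) l22 ∧ permute L1 l22); under the binder l22 = v0, X = v1, L1 = v2, L2 = v3
  cbody cPermCons  = ex lst (atom split (v3 ∷ₐ (v1 :: nilT) ∷ₐ v0 ∷ₐ []ₐ)
                             ∧ atom permute (v2 ∷ₐ v0 ∷ₐ []ₐ))

  Unifies : ∀ {Δ Ξ Δ'} → Fm Δ → Fm Ξ → Sub Δ Δ' → Sub Ξ Δ' → Set
  Unifies A H θ θ' = subF θ A ≈F subF θ' H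

  record CSU {Δ Ξ : Ctx} (A : Fm Δ) (H : Fm Ξ) : Set₁ where
    field
      mem      : (Δ' : Ctx) → Sub Δ Δ' → Sub Ξ Δ' → Set
      sound    : ∀ {Δ'} (θ : Sub Δ Δ') (θ' : Sub Ξ Δ') → mem Δ' θ θ' → Unifies A H θ θ'
      complete : ∀ {Δ''} (σ : Sub Δ Δ'') (σ' : Sub Ξ Δ'') → Unifies A H σ σ' →
                 Σ Ctx λ Δ' → Σ (Sub Δ Δ') λ θ → Σ (Sub Ξ Δ') λ θ' →
                 mem Δ' θ θ' × Σ (Sub Δ' Δ'') λ ρ →
                 (∀ {ρ₀} (v : Δ ∋ ρ₀) → σ v ≈ sub ρ (θ v)) ×
                 (∀ {ρ₀} (v : Ξ ∋ ρ₀) → σ' v ≈ sub ρ (θ' v))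
  open CSU public

  record Seq : Set where
    constructor seq
    field
      sctx : Ctx
      shyp : List (Fm sctx)
      sconc : Fm sctx

  data Inst (ps : List Seq) (Δ : Ctx) (Γ : List (Fm Δ)) (C : Fm Δ) : Set where
    inst : ∀ {Δ₀ Γ₀ C₀} → ps ∋ seq Δ₀ Γ₀ C₀ → (ρ : Sub Δ₀ Δ) →
           Γ ≡ map (subF ρ) Γ₀ → C ≡ subF ρ C₀ → Inst ps Δ Γ C

  sucSub : ∀ {Δ} → Sub (nt ∷ Δ) (nt ∷ Δ)
  sucSub here      = sT (var here)
  sucSub (there v) = var (there v)

  data Deriv (Leaf : (Δ : Ctx) → List (Fm Δ) → Fm Δ → Set) :
             (Δ : Ctx) → List (Fm Δ) → Fm Δ → Set₁ where
    leaf  : ∀ {Δ Γ C} → Leaf Δ Γ C → Deriv Leaf Δ Γ C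
    -- structural: multiset (exchange), terms up to αβη, contraction, cut
    exch  : ∀ {Δ Γ Γ' C} → Γ ↭ Γ' → Deriv Leaf Δ Γ C → Deriv Leaf Δ Γ' C
    conv  : ∀ {Δ Γ Γ' C C'} → Γ ≈L Γ' → C ≈F C' → Deriv Leaf Δ Γ C → Deriv Leaf Δ Γ' C'
    contr : ∀ {Δ A Γ C} → Deriv Leaf Δ (A ∷ A ∷ Γ) C → Deriv Leaf Δ (A ∷ Γ) C
    cut   : ∀ {Δ Γ₁ Γ₂ A C} → Deriv Leaf Δ Γ₁ A → Deriv Leaf Δ (A ∷ Γ₂) C →
            Deriv Leaf Δ (Γ₁ Data.List.++ Γ₂) C
    init  : ∀ {Δ Γ} p (ts : Args Δ (arity p)) → Deriv Leaf Δ (atom p ts ∷ Γ) (atom p ts)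
    ⊥L    : ∀ {Δ Γ C} → Deriv Leaf Δ (⊥′ ∷ Γ) C
    ⊤R    : ∀ {Δ Γ} → Deriv Leaf Δ Γ ⊤′
    ∧L₁   : ∀ {Δ Γ A B C} → Deriv Leaf Δ (A ∷ Γ) C → Deriv Leaf Δ ((A ∧ B) ∷ Γ) C
    ∧L₂   : ∀ {Δ Γ A B C} → Deriv Leaf Δ (B ∷ Γ) C → Deriv Leaf Δ ((A ∧ B) ∷ Γ) C
    ∧R    : ∀ {Δ Γ A B} → Deriv Leaf Δ Γ A → Deriv Leaf Δ Γ B → Deriv Leaf Δ Γ (A ∧ B)
    ∨L    : ∀ {Δ Γ A B C} → Deriv Leaf Δ (A ∷ Γ) C → Deriv Leaf Δ (B ∷ Γ) C →
            Deriv Leaf Δ ((A ∨ B) ∷ Γ) C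
    ∨R₁   : ∀ {Δ Γ A B} → Deriv Leaf Δ Γ A → Deriv Leaf Δ Γ (A ∨ B)
    ∨R₂   : ∀ {Δ Γ A B} → Deriv Leaf Δ Γ B → Deriv Leaf Δ Γ (A ∨ B)
    ⊃L    : ∀ {Δ Γ A B C} → Deriv Leaf Δ Γ A → Deriv Leaf Δ (B ∷ Γ) C →
            Deriv Leaf Δ ((A ⊃ B) ∷ Γ) C
    ⊃R    : ∀ {Δ Γ A B} → Deriv Leaf Δ (A ∷ Γ) B → Deriv Leaf Δ Γ (A ⊃ B)
    -- quantifier rules (eigenvariable = fresh innermost de Bruijn variable)
    ∀L    : ∀ {Δ Γ σ B C} (t : Tm Δ σ) → Deriv Leaf Δ (B ⟪ t ⟫ ∷ Γ) C →
            Deriv Leaf Δ (all σ B ∷ Γ) C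
    ∀R    : ∀ {Δ Γ σ B} → Deriv Leaf (σ ∷ Δ) (map (renF there) Γ) B →
            Deriv Leaf Δ Γ (all σ B)
    ∃L    : ∀ {Δ Γ σ B C} → Deriv Leaf (σ ∷ Δ) (B ∷ map (renF there) Γ) (renF there C) →
            Deriv Leaf Δ (ex σ B ∷ Γ) C
    ∃R    : ∀ {Δ Γ σ B} (t : Tm Δ σ) → Deriv Leaf Δ Γ (B ⟪ t ⟫) →
            Deriv Leaf Δ Γ (ex σ B)
    natZ  : ∀ {Δ Γ} → Deriv Leaf Δ Γ (atom nat (zT ∷ₐ []ₐ))
    natS  : ∀ {Δ Γ} {I : Tm Δ nt} → Deriv Leaf Δ Γ (atom nat (I ∷ₐ []ₐ)) →
            Deriv Leaf Δ Γ (atom nat (sT I ∷ₐ []ₐ))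
    natL  : ∀ {Δ Γ C} (B : Fm (nt ∷ Δ)) (I : Tm Δ nt) →
            Deriv Leaf Δ [] (B ⟪ zT ⟫) →
            Deriv Leaf (nt ∷ Δ) (B ∷ []) (subF sucSub B) →
            Deriv Leaf Δ (B ⟪ I ⟫ ∷ Γ) C →
            Deriv Leaf Δ (atom nat (I ∷ₐ []ₐ) ∷ Γ) C
    defR  : ∀ {Δ Γ} (c : Clause) (θ : Sub (cctx c) Δ) →
            Deriv Leaf Δ Γ (subF θ (cbody c)) →
            Deriv Leaf Δ Γ (subF θ (chead c))
    defL  : ∀ {Δ Γ C} (p : Pred) → Defined p → (us : Args Δ (arity p)) →
            (S : (c : Clause) → CSU (atom p us) (chead c)) →
            (∀ c {Δ'} (θ : Sub Δ Δ') (θ' : Sub (cctx c) Δ') → mem (S c) Δ' θ θ' →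
               Deriv Leaf Δ' (subF θ' (cbody c) ∷ map (subF θ) Γ) (subF θ C)) →
            Deriv Leaf Δ (atom p us ∷ Γ) C

  DerivableFrom : List Seq → Seq → Set₁
  DerivableFrom ps (seq Δ Γ C) = Deriv (Inst ps) Δ Γ C

  -- substitution used for the premise  B l ⟶ B (x::l)  in context  x:τ, l:lst, Δ
  liftSub2 : ∀ {Δ} → Tm (τ ∷ lst ∷ Δ) lst → Sub (lst ∷ Δ) (τ ∷ lst ∷ Δ)
  liftSub2 t here      = t
  liftSub2 t (there v) = var (there (there v))

  xV : ∀ {Δ} → Tm (τ ∷ lst ∷ Δ) τ
  xV = var here

  lV : ∀ {Δ} → Tm (τ ∷ lst ∷ Δ) lst
  lV = var (there here)

-- `list L` unfolds to ∃i. nat i ∧ length L i, so the rule follows by induction on nat i with the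
-- invariant  λj. ∀l. length l j ⊃ B l.  At z only the nil clause of length applies (first premise);
-- at s j only the cons clause does, and its body is the invariant at j (second premise).
-- The definition rules are used with the complete set of all unifiers, so the clauses that do not
-- apply must be refuted modulo αβη-conversion: this needs z ≉ s t and the injectivity of s, which
-- are read off a logical-relations model in which a numeral built with s remembers its predecessor.
module Submission where

open import Defs
open import Data.Empty using (⊥; ⊥-elim)
open import Data.List using (List; []; _∷_; map; _++_)
open import Data.List.Properties using (map-∘; map-cong)
open import Data.List.Relation.Binary.Permutation.Propositional using (↭-refl; ↭-swap)
open import Data.Maybe using (Maybe; just; nothing)
open import Data.Product using (_×_; _,_; proj₁; proj₂)
open import Data.Unit using (⊤; tt)
open import Relation.Binary.Bundles using (Setoid)
open import Relation.Binary.PropositionalEquality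
  using (_≡_; refl; sym; trans; cong; cong₂; module ≡-Reasoning)
open import Relation.Nullary using (¬_)
import Relation.Binary.Reasoning.Setoid as SetoidReasoning

module Substitution (τ : Ty) (Sig : List Ty) (PSig : List (List Ty)) where
  open FOλ τ Sig PSig

  infix 4 _≗ᵥ_
  _≗ᵥ_ : ∀ {Δ} {F : Ty → Set} (f g : ∀ {σ} → Δ ∋ σ → F σ) → Set
  f ≗ᵥ g = ∀ {σ} v → f {σ} v ≡ g v

  infixr 5 _∷ₛ_
  _∷ₛ_ : ∀ {Δ Δ' σ} → Tm Δ' σ → Sub Δ Δ' → Sub (σ ∷ Δ) Δ'
  (t ∷ₛ s) here      = t
  (t ∷ₛ s) (there v) = s v

  ext-cong : ∀ {Δ Δ' ρ} {r r' : Ren Δ Δ'} → r ≗ᵥ r' → ext {ρ = ρ} r ≗ᵥ ext r'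
  ext-cong r≗r' here      = refl
  ext-cong r≗r' (there v) = cong there (r≗r' v)

  exts-cong : ∀ {Δ Δ' ρ} {s s' : Sub Δ Δ'} → s ≗ᵥ s' → exts {ρ = ρ} s ≗ᵥ exts s'
  exts-cong s≗s' here      = refl
  exts-cong s≗s' (there v) = cong (ren there) (s≗s' v)

  ren-cong : ∀ {Δ Δ' σ} {r r' : Ren Δ Δ'} → r ≗ᵥ r' → (t : Tm Δ σ) → ren r t ≡ ren r' t
  ren-cong r≗r' (var v)   = cong var (r≗r' v)
  ren-cong r≗r' (cst c)   = refl
  ren-cong r≗r' (lam t)   = cong lam (ren-cong (ext-cong r≗r') t)
  ren-cong r≗r' (app t u) = cong₂ app (ren-cong r≗r' t) (ren-cong r≗r' u)

  sub-cong : ∀ {Δ Δ' σ} {s s' : Sub Δ Δ'} → s ≗ᵥ s' → (t : Tm Δ σ) → sub s t ≡ sub s' t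
  sub-cong s≗s' (var v)   = s≗s' v
  sub-cong s≗s' (cst c)   = refl
  sub-cong s≗s' (lam t)   = cong lam (sub-cong (exts-cong s≗s') t)
  sub-cong s≗s' (app t u) = cong₂ app (sub-cong s≗s' t) (sub-cong s≗s' u)

  ren-ren : ∀ {Δ₁ Δ₂ Δ₃ σ} (r : Ren Δ₂ Δ₃) (r' : Ren Δ₁ Δ₂) (t : Tm Δ₁ σ) →
            ren r (ren r' t) ≡ ren (λ v → r (r' v)) t
  ren-ren r r' (var v)   = refl
  ren-ren r r' (cst c)   = refl
  ren-ren r r' (lam t)   = cong lam (trans (ren-ren (ext r) (ext r') t)
                             (ren-cong (λ { here → refl ; (there v) → refl }) t))
  ren-ren r r' (app t u) = cong₂ app (ren-ren r r' t) (ren-ren r r' u)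

  ren-ext-exts : ∀ {Δ₁ Δ₂ Δ₃ ρ} (r : Ren Δ₂ Δ₃) (s : Sub Δ₁ Δ₂) →
                 (λ {σ} v → ren (ext r) (exts {ρ = ρ} s {σ} v)) ≗ᵥ exts (λ v → ren r (s v))
  ren-ext-exts r s here      = refl
  ren-ext-exts r s (there v) = trans (ren-ren (ext r) there (s v)) (sym (ren-ren there r (s v)))

  ren-sub : ∀ {Δ₁ Δ₂ Δ₃ σ} (r : Ren Δ₂ Δ₃) (s : Sub Δ₁ Δ₂) (t : Tm Δ₁ σ) →
            ren r (sub s t) ≡ sub (λ v → ren r (s v)) t
  ren-sub r s (var v)   = refl
  ren-sub r s (cst c)   = refl
  ren-sub r s (lam t)   = cong lam (trans (ren-sub (ext r) (exts s) t) (sub-cong (ren-ext-exts r s) t))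
  ren-sub r s (app t u) = cong₂ app (ren-sub r s t) (ren-sub r s u)

  sub-ren : ∀ {Δ₁ Δ₂ Δ₃ σ} (s : Sub Δ₂ Δ₃) (r : Ren Δ₁ Δ₂) (t : Tm Δ₁ σ) →
            sub s (ren r t) ≡ sub (λ v → s (r v)) t
  sub-ren s r (var v)   = refl
  sub-ren s r (cst c)   = refl
  sub-ren s r (lam t)   = cong lam (trans (sub-ren (exts s) (ext r) t)
                            (sub-cong (λ { here → refl ; (there v) → refl }) t))
  sub-ren s r (app t u) = cong₂ app (sub-ren s r t) (sub-ren s r u)

  sub-exts-weaken : ∀ {Δ Δ' σ ρ} (s : Sub Δ Δ') (t : Tm Δ σ) →
                    sub (exts {ρ = ρ} s) (ren there t) ≡ ren there (sub s t)
  sub-exts-weaken s t = trans (sub-ren (exts s) there t) (sym (ren-sub there s t))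

  sub-exts-exts : ∀ {Δ₁ Δ₂ Δ₃ ρ} (s : Sub Δ₂ Δ₃) (s' : Sub Δ₁ Δ₂) →
                  (λ {σ} v → sub (exts s) (exts {ρ = ρ} s' {σ} v)) ≗ᵥ exts (λ v → sub s (s' v))
  sub-exts-exts s s' here      = refl
  sub-exts-exts s s' (there v) = sub-exts-weaken s (s' v)

  sub-sub : ∀ {Δ₁ Δ₂ Δ₃ σ} (s : Sub Δ₂ Δ₃) (s' : Sub Δ₁ Δ₂) (t : Tm Δ₁ σ) →
            sub s (sub s' t) ≡ sub (λ v → sub s (s' v)) t
  sub-sub s s' (var v)   = refl
  sub-sub s s' (cst c)   = refl
  sub-sub s s' (lam t)   = cong lam (trans (sub-sub (exts s) (exts s') t) (sub-cong (sub-exts-exts s s') t))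
  sub-sub s s' (app t u) = cong₂ app (sub-sub s s' t) (sub-sub s s' u)

  sub-id : ∀ {Δ σ} (t : Tm Δ σ) → sub var t ≡ t
  sub-id (var v)   = refl
  sub-id (cst c)   = refl
  sub-id (lam t)   = cong lam (trans (sub-cong (λ { here → refl ; (there v) → refl }) t) (sub-id t))
  sub-id (app t u) = cong₂ app (sub-id t) (sub-id u)

  ren-as-sub : ∀ {Δ Δ' σ} (r : Ren Δ Δ') (t : Tm Δ σ) → ren r t ≡ sub (λ v → var (r v)) t
  ren-as-sub r (var v)   = refl
  ren-as-sub r (cst c)   = refl
  ren-as-sub r (lam t)   = cong lam (trans (ren-as-sub (ext r) t)
                             (sub-cong (λ { here → refl ; (there v) → refl }) t))
  ren-as-sub r (app t u) = cong₂ app (ren-as-sub r t) (ren-as-sub r u)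

  sub-sub-ren : ∀ {Δ₁ Δ₂ Δ₃ Δ₄ σ} (s : Sub Δ₃ Δ₄) (s' : Sub Δ₂ Δ₃) (r : Ren Δ₁ Δ₂)
                (t : Tm Δ₁ σ) →
                sub s (sub s' (ren r t)) ≡ sub (λ v → sub s (s' (r v))) t
  sub-sub-ren s s' r t = trans (cong (sub s) (sub-ren s' r t)) (sub-sub s _ t)

  sub1-weaken : ∀ {Δ σ ρ} (u : Tm Δ ρ) (t : Tm Δ σ) → sub (sub1 u) (ren there t) ≡ t
  sub1-weaken u t = trans (sub-ren (sub1 u) there t) (sub-id t)

  subA-cong : ∀ {Δ Δ' as} {s s' : Sub Δ Δ'} → s ≗ᵥ s' → (ts : Args Δ as) → subA s ts ≡ subA s' ts
  subA-cong s≗s' []ₐ       = refl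
  subA-cong s≗s' (t ∷ₐ ts) = cong₂ _∷ₐ_ (sub-cong s≗s' t) (subA-cong s≗s' ts)

  renA-sub : ∀ {Δ₁ Δ₂ Δ₃ as} (r : Ren Δ₂ Δ₃) (s : Sub Δ₁ Δ₂) (ts : Args Δ₁ as) →
             renA r (subA s ts) ≡ subA (λ v → ren r (s v)) ts
  renA-sub r s []ₐ       = refl
  renA-sub r s (t ∷ₐ ts) = cong₂ _∷ₐ_ (ren-sub r s t) (renA-sub r s ts)

  subA-ren : ∀ {Δ₁ Δ₂ Δ₃ as} (s : Sub Δ₂ Δ₃) (r : Ren Δ₁ Δ₂) (ts : Args Δ₁ as) →
             subA s (renA r ts) ≡ subA (λ v → s (r v)) ts
  subA-ren s r []ₐ       = refl
  subA-ren s r (t ∷ₐ ts) = cong₂ _∷ₐ_ (sub-ren s r t) (subA-ren s r ts)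

  subA-sub : ∀ {Δ₁ Δ₂ Δ₃ as} (s : Sub Δ₂ Δ₃) (s' : Sub Δ₁ Δ₂) (ts : Args Δ₁ as) →
             subA s (subA s' ts) ≡ subA (λ v → sub s (s' v)) ts
  subA-sub s s' []ₐ       = refl
  subA-sub s s' (t ∷ₐ ts) = cong₂ _∷ₐ_ (sub-sub s s' t) (subA-sub s s' ts)

  subA-id : ∀ {Δ as} (ts : Args Δ as) → subA var ts ≡ ts
  subA-id []ₐ       = refl
  subA-id (t ∷ₐ ts) = cong₂ _∷ₐ_ (sub-id t) (subA-id ts)

  subF-cong : ∀ {Δ Δ'} {s s' : Sub Δ Δ'} → s ≗ᵥ s' → (F : Fm Δ) → subF s F ≡ subF s' F
  subF-cong s≗s' (atom p ts) = cong (atom p) (subA-cong s≗s' ts)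
  subF-cong s≗s' ⊥′          = refl
  subF-cong s≗s' ⊤′          = refl
  subF-cong s≗s' (A ∧ A')    = cong₂ _∧_ (subF-cong s≗s' A) (subF-cong s≗s' A')
  subF-cong s≗s' (A ∨ A')    = cong₂ _∨_ (subF-cong s≗s' A) (subF-cong s≗s' A')
  subF-cong s≗s' (A ⊃ A')    = cong₂ _⊃_ (subF-cong s≗s' A) (subF-cong s≗s' A')
  subF-cong s≗s' (all σ A)   = cong (all σ) (subF-cong (exts-cong s≗s') A)
  subF-cong s≗s' (ex σ A)    = cong (ex σ) (subF-cong (exts-cong s≗s') A)

  renF-sub : ∀ {Δ₁ Δ₂ Δ₃} (r : Ren Δ₂ Δ₃) (s : Sub Δ₁ Δ₂) (F : Fm Δ₁) →
             renF r (subF s F) ≡ subF (λ v → ren r (s v)) F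
  renF-sub r s (atom p ts) = cong (atom p) (renA-sub r s ts)
  renF-sub r s ⊥′          = refl
  renF-sub r s ⊤′          = refl
  renF-sub r s (A ∧ A')    = cong₂ _∧_ (renF-sub r s A) (renF-sub r s A')
  renF-sub r s (A ∨ A')    = cong₂ _∨_ (renF-sub r s A) (renF-sub r s A')
  renF-sub r s (A ⊃ A')    = cong₂ _⊃_ (renF-sub r s A) (renF-sub r s A')
  renF-sub r s (all σ A)   = cong (all σ) (trans (renF-sub (ext r) (exts s) A) (subF-cong (ren-ext-exts r s) A))
  renF-sub r s (ex σ A)    = cong (ex σ) (trans (renF-sub (ext r) (exts s) A) (subF-cong (ren-ext-exts r s) A))

  subF-ren : ∀ {Δ₁ Δ₂ Δ₃} (s : Sub Δ₂ Δ₃) (r : Ren Δ₁ Δ₂) (F : Fm Δ₁) →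
             subF s (renF r F) ≡ subF (λ v → s (r v)) F
  subF-ren s r (atom p ts) = cong (atom p) (subA-ren s r ts)
  subF-ren s r ⊥′          = refl
  subF-ren s r ⊤′          = refl
  subF-ren s r (A ∧ A')    = cong₂ _∧_ (subF-ren s r A) (subF-ren s r A')
  subF-ren s r (A ∨ A')    = cong₂ _∨_ (subF-ren s r A) (subF-ren s r A')
  subF-ren s r (A ⊃ A')    = cong₂ _⊃_ (subF-ren s r A) (subF-ren s r A')
  subF-ren s r (all σ A)   = cong (all σ) (trans (subF-ren (exts s) (ext r) A)
                               (subF-cong (λ { here → refl ; (there v) → refl }) A))
  subF-ren s r (ex σ A)    = cong (ex σ) (trans (subF-ren (exts s) (ext r) A)
                               (subF-cong (λ { here → refl ; (there v) → refl }) A))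

  subF-sub : ∀ {Δ₁ Δ₂ Δ₃} (s : Sub Δ₂ Δ₃) (s' : Sub Δ₁ Δ₂) (F : Fm Δ₁) →
             subF s (subF s' F) ≡ subF (λ v → sub s (s' v)) F
  subF-sub s s' (atom p ts) = cong (atom p) (subA-sub s s' ts)
  subF-sub s s' ⊥′          = refl
  subF-sub s s' ⊤′          = refl
  subF-sub s s' (A ∧ A')    = cong₂ _∧_ (subF-sub s s' A) (subF-sub s s' A')
  subF-sub s s' (A ∨ A')    = cong₂ _∨_ (subF-sub s s' A) (subF-sub s s' A')
  subF-sub s s' (A ⊃ A')    = cong₂ _⊃_ (subF-sub s s' A) (subF-sub s s' A')
  subF-sub s s' (all σ A)   = cong (all σ) (trans (subF-sub (exts s) (exts s') A) (subF-cong (sub-exts-exts s s') A))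
  subF-sub s s' (ex σ A)    = cong (ex σ) (trans (subF-sub (exts s) (exts s') A) (subF-cong (sub-exts-exts s s') A))

  subF-id : ∀ {Δ} (F : Fm Δ) → subF var F ≡ F
  subF-id (atom p ts) = cong (atom p) (subA-id ts)
  subF-id ⊥′          = refl
  subF-id ⊤′          = refl
  subF-id (A ∧ A')    = cong₂ _∧_ (subF-id A) (subF-id A')
  subF-id (A ∨ A')    = cong₂ _∨_ (subF-id A) (subF-id A')
  subF-id (A ⊃ A')    = cong₂ _⊃_ (subF-id A) (subF-id A')
  subF-id (all σ A)   = cong (all σ) (trans (subF-cong (λ { here → refl ; (there v) → refl }) A) (subF-id A))
  subF-id (ex σ A)    = cong (ex σ) (trans (subF-cong (λ { here → refl ; (there v) → refl }) A) (subF-id A))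

  subF-subF : ∀ {Δ₁ Δ₂ Δ₃} (s : Sub Δ₂ Δ₃) (s' : Sub Δ₁ Δ₂) {s'' : Sub Δ₁ Δ₃} →
              (λ {σ} v → sub s (s' {σ} v)) ≗ᵥ s'' → (F : Fm Δ₁) → subF s (subF s' F) ≡ subF s'' F
  subF-subF s s' s⊙s'≗s'' F = trans (subF-sub s s' F) (subF-cong s⊙s'≗s'' F)

  sub1-var-renF-ext : ∀ {Δ σ} (A : Fm (σ ∷ Δ)) → subF (sub1 (var here)) (renF (ext there) A) ≡ A
  sub1-var-renF-ext A =
    trans (subF-ren _ _ A) (trans (subF-cong (λ { here → refl ; (there v) → refl }) A) (subF-id A))

  map-renF-subF : ∀ {Δ₁ Δ₂ Δ₃} (r : Ren Δ₂ Δ₃) (s : Sub Δ₁ Δ₂) (Γ : List (Fm Δ₁)) →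
                  map (renF r) (map (subF s) Γ) ≡ map (subF (λ v → ren r (s v))) Γ
  map-renF-subF r s Γ = trans (sym (map-∘ Γ)) (map-cong (renF-sub r s) Γ)

module Conversion (τ : Ty) (Sig : List Ty) (PSig : List (List Ty)) where
  open FOλ τ Sig PSig
  open Substitution τ Sig PSig

  ≡⇒≈ : ∀ {Δ σ} {t u : Tm Δ σ} → t ≡ u → t ≈ u
  ≡⇒≈ refl = ≈refl

  sub-resp-≈ : ∀ {Δ Δ' σ} (s : Sub Δ Δ') {t u : Tm Δ σ} → t ≈ u → sub s t ≈ sub s u
  sub-resp-≈ s ≈refl             = ≈refl
  sub-resp-≈ s (≈sym t≈u)        = ≈sym (sub-resp-≈ s t≈u)
  sub-resp-≈ s (≈trans t≈u u≈v)  = ≈trans (sub-resp-≈ s t≈u) (sub-resp-≈ s u≈v)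
  sub-resp-≈ s (≈lam t≈u)        = ≈lam (sub-resp-≈ (exts s) t≈u)
  sub-resp-≈ s (≈app t≈t' u≈u')  = ≈app (sub-resp-≈ s t≈t') (sub-resp-≈ s u≈u')
  sub-resp-≈ s (≈β t u)          = ≈trans (≈β (sub (exts s) t) (sub s u)) (≡⇒≈ (begin
    sub (sub1 (sub s u)) (sub (exts s) t)          ≡⟨ sub-sub (sub1 (sub s u)) (exts s) t ⟩
    sub (λ v → sub (sub1 (sub s u)) (exts s v)) t  ≡⟨ sub-cong sub1-exts t ⟩
    sub (λ v → sub s (sub1 u v)) t                 ≡⟨ sub-sub s (sub1 u) t ⟨
    sub s (sub (sub1 u) t)                         ∎))
    where
    open ≡-Reasoning
    sub1-exts : (λ {σ} v → sub (sub1 (sub s u)) (exts s {σ} v)) ≗ᵥ (λ v → sub s (sub1 u v))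
    sub1-exts here      = refl
    sub1-exts (there v) = sub1-weaken (sub s u) (s v)
  sub-resp-≈ s (≈η t)            =
    ≈trans (≈η (sub s t)) (≡⇒≈ (cong (λ t' → lam (app t' (var here))) (sym (sub-exts-weaken s t))))

  ren-resp-≈ : ∀ {Δ Δ' σ} (r : Ren Δ Δ') {t u : Tm Δ σ} → t ≈ u → ren r t ≈ ren r u
  ren-resp-≈ r {t} {u} t≈u =
    ≈trans (≡⇒≈ (ren-as-sub r t)) (≈trans (sub-resp-≈ _ t≈u) (≡⇒≈ (sym (ren-as-sub r u))))

  infix 4 _≈ₛ_
  _≈ₛ_ : ∀ {Δ Δ'} → Sub Δ Δ' → Sub Δ Δ' → Set
  s ≈ₛ s' = ∀ {σ} v → s {σ} v ≈ s' v

  exts-resp-≈ₛ : ∀ {Δ Δ' ρ} {s s' : Sub Δ Δ'} → s ≈ₛ s' → exts {ρ = ρ} s ≈ₛ exts s'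
  exts-resp-≈ₛ s≈s' here      = ≈refl
  exts-resp-≈ₛ s≈s' (there v) = ren-resp-≈ there (s≈s' v)

  sub-resp-≈ₛ : ∀ {Δ Δ' σ} {s s' : Sub Δ Δ'} → s ≈ₛ s' → (t : Tm Δ σ) → sub s t ≈ sub s' t
  sub-resp-≈ₛ s≈s' (var v)   = s≈s' v
  sub-resp-≈ₛ s≈s' (cst c)   = ≈refl
  sub-resp-≈ₛ s≈s' (lam t)   = ≈lam (sub-resp-≈ₛ (exts-resp-≈ₛ s≈s') t)
  sub-resp-≈ₛ s≈s' (app t u) = ≈app (sub-resp-≈ₛ s≈s' t) (sub-resp-≈ₛ s≈s' u)

  subA-resp-≈ₛ : ∀ {Δ Δ' as} {s s' : Sub Δ Δ'} → s ≈ₛ s' →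
                 (ts : Args Δ as) → subA s ts ≈ₐ subA s' ts
  subA-resp-≈ₛ s≈s' []ₐ       = []≈
  subA-resp-≈ₛ s≈s' (t ∷ₐ ts) = ∷≈ (sub-resp-≈ₛ s≈s' t) (subA-resp-≈ₛ s≈s' ts)

  subF-resp-≈ₛ : ∀ {Δ Δ'} {s s' : Sub Δ Δ'} → s ≈ₛ s' → (F : Fm Δ) → subF s F ≈F subF s' F
  subF-resp-≈ₛ s≈s' (atom p ts) = atom≈ p (subA-resp-≈ₛ s≈s' ts)
  subF-resp-≈ₛ s≈s' ⊥′          = ⊥≈
  subF-resp-≈ₛ s≈s' ⊤′          = ⊤≈
  subF-resp-≈ₛ s≈s' (A ∧ A')    = ∧≈ (subF-resp-≈ₛ s≈s' A) (subF-resp-≈ₛ s≈s' A')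
  subF-resp-≈ₛ s≈s' (A ∨ A')    = ∨≈ (subF-resp-≈ₛ s≈s' A) (subF-resp-≈ₛ s≈s' A')
  subF-resp-≈ₛ s≈s' (A ⊃ A')    = ⊃≈ (subF-resp-≈ₛ s≈s' A) (subF-resp-≈ₛ s≈s' A')
  subF-resp-≈ₛ s≈s' (all σ A)   = all≈ (subF-resp-≈ₛ (exts-resp-≈ₛ s≈s') A)
  subF-resp-≈ₛ s≈s' (ex σ A)    = ex≈ (subF-resp-≈ₛ (exts-resp-≈ₛ s≈s') A)

  ≈ₐ-refl : ∀ {Δ as} (ts : Args Δ as) → ts ≈ₐ ts
  ≈ₐ-refl []ₐ       = []≈
  ≈ₐ-refl (t ∷ₐ ts) = ∷≈ ≈refl (≈ₐ-refl ts)

  ≈ₐ-sym : ∀ {Δ as} {ts us : Args Δ as} → ts ≈ₐ us → us ≈ₐ ts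
  ≈ₐ-sym []≈          = []≈
  ≈ₐ-sym (∷≈ t≈u ts≈us) = ∷≈ (≈sym t≈u) (≈ₐ-sym ts≈us)

  ≈ₐ-trans : ∀ {Δ as} {ts us ws : Args Δ as} → ts ≈ₐ us → us ≈ₐ ws → ts ≈ₐ ws
  ≈ₐ-trans []≈              []≈              = []≈
  ≈ₐ-trans (∷≈ t≈u ts≈us) (∷≈ u≈w us≈ws) = ∷≈ (≈trans t≈u u≈w) (≈ₐ-trans ts≈us us≈ws)

  ≈F-refl : ∀ {Δ} (F : Fm Δ) → F ≈F F
  ≈F-refl (atom p ts) = atom≈ p (≈ₐ-refl ts)
  ≈F-refl ⊥′          = ⊥≈
  ≈F-refl ⊤′          = ⊤≈
  ≈F-refl (A ∧ A')    = ∧≈ (≈F-refl A) (≈F-refl A')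
  ≈F-refl (A ∨ A')    = ∨≈ (≈F-refl A) (≈F-refl A')
  ≈F-refl (A ⊃ A')    = ⊃≈ (≈F-refl A) (≈F-refl A')
  ≈F-refl (all σ A)   = all≈ (≈F-refl A)
  ≈F-refl (ex σ A)    = ex≈ (≈F-refl A)

  ≈F-sym : ∀ {Δ} {F G : Fm Δ} → F ≈F G → G ≈F F
  ≈F-sym (atom≈ p ts≈us) = atom≈ p (≈ₐ-sym ts≈us)
  ≈F-sym ⊥≈              = ⊥≈
  ≈F-sym ⊤≈              = ⊤≈
  ≈F-sym (∧≈ A≈ A'≈)     = ∧≈ (≈F-sym A≈) (≈F-sym A'≈)
  ≈F-sym (∨≈ A≈ A'≈)     = ∨≈ (≈F-sym A≈) (≈F-sym A'≈)
  ≈F-sym (⊃≈ A≈ A'≈)     = ⊃≈ (≈F-sym A≈) (≈F-sym A'≈)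
  ≈F-sym (all≈ A≈)       = all≈ (≈F-sym A≈)
  ≈F-sym (ex≈ A≈)        = ex≈ (≈F-sym A≈)

  ≈F-trans : ∀ {Δ} {F G H : Fm Δ} → F ≈F G → G ≈F H → F ≈F H
  ≈F-trans (atom≈ p ts≈us) (atom≈ .p us≈ws) = atom≈ p (≈ₐ-trans ts≈us us≈ws)
  ≈F-trans ⊥≈              ⊥≈               = ⊥≈
  ≈F-trans ⊤≈              ⊤≈               = ⊤≈
  ≈F-trans (∧≈ A≈ A'≈)     (∧≈ B≈ B'≈)      = ∧≈ (≈F-trans A≈ B≈) (≈F-trans A'≈ B'≈)
  ≈F-trans (∨≈ A≈ A'≈)     (∨≈ B≈ B'≈)      = ∨≈ (≈F-trans A≈ B≈) (≈F-trans A'≈ B'≈)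
  ≈F-trans (⊃≈ A≈ A'≈)     (⊃≈ B≈ B'≈)      = ⊃≈ (≈F-trans A≈ B≈) (≈F-trans A'≈ B'≈)
  ≈F-trans (all≈ A≈)       (all≈ B≈)        = all≈ (≈F-trans A≈ B≈)
  ≈F-trans (ex≈ A≈)        (ex≈ B≈)         = ex≈ (≈F-trans A≈ B≈)

  ≡⇒≈F : ∀ {Δ} {F G : Fm Δ} → F ≡ G → F ≈F G
  ≡⇒≈F {F = F} refl = ≈F-refl F

  ≈F-setoid : Ctx → Setoid _ _
  ≈F-setoid Δ = record
    { Carrier       = Fm Δ
    ; _≈_           = _≈F_
    ; isEquivalence = record { refl = ≈F-refl _ ; sym = ≈F-sym ; trans = ≈F-trans }
    }

  ≈L-refl : ∀ {Δ} (Γ : List (Fm Δ)) → Γ ≈L Γ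
  ≈L-refl []      = []≈
  ≈L-refl (A ∷ Γ) = ∷≈ (≈F-refl A) (≈L-refl Γ)

module ConversionModel (τ : Ty) (Sig : List Ty) (PSig : List (List Ty)) where
  open FOλ τ Sig PSig
  open Substitution τ Sig PSig
  open Conversion τ Sig PSig

  -- The third component of Related at σ ⇒ ρ (reifying an application agrees with applying the reified
  -- function) is what makes reify-eval go through at app.
  module Model (Ω : Ctx) where

    Val : Ty → Set
    Val (base n) = Tm Ω (base n)
    Val nt       = Tm Ω nt × Maybe (Tm Ω nt)
    Val lst      = Tm Ω lst
    Val (σ ⇒ ρ)  = Tm Ω (σ ⇒ ρ) × (Val σ → Val ρ)

    reify : ∀ σ → Val σ → Tm Ω σ
    reify (base n) t      = t
    reify nt (t , _)      = t
    reify lst t           = t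
    reify (σ ⇒ ρ) (t , _) = t

    reflect : ∀ σ → Tm Ω σ → Val σ
    reflect (base n) t = t
    reflect nt t       = t , nothing
    reflect lst t      = t
    reflect (σ ⇒ ρ) t  = t , λ a → reflect ρ (app t (reify σ a))

    reify-reflect : ∀ σ (t : Tm Ω σ) → reify σ (reflect σ t) ≡ t
    reify-reflect (base n) t = refl
    reify-reflect nt t       = refl
    reify-reflect lst t      = refl
    reify-reflect (σ ⇒ ρ) t  = refl

    PredecessorRel : Maybe (Tm Ω nt) → Maybe (Tm Ω nt) → Set
    PredecessorRel nothing  nothing  = ⊤
    PredecessorRel (just t) (just u) = t ≈ u
    PredecessorRel _        _        = ⊥

    Related : ∀ σ → Val σ → Val σ → Set
    Related (base n) t u                = t ≈ u
    Related nt (t , m) (u , m')         = t ≈ u × PredecessorRel m m'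
    Related lst t u                     = t ≈ u
    Related (σ ⇒ ρ) (t , f) (u , g) =
      t ≈ u × (∀ a b → Related σ a b → Related ρ (f a) (g b))
            × (∀ a → Related σ a a → reify ρ (f a) ≈ app t (reify σ a))

    Related⇒≈ : ∀ σ {a b} → Related σ a b → reify σ a ≈ reify σ b
    Related⇒≈ (base n) a~b = a~b
    Related⇒≈ nt a~b       = proj₁ a~b
    Related⇒≈ lst a~b      = a~b
    Related⇒≈ (σ ⇒ ρ) a~b  = proj₁ a~b

    PredecessorRel-sym : ∀ {m m'} → PredecessorRel m m' → PredecessorRel m' m
    PredecessorRel-sym {nothing} {nothing} _   = tt
    PredecessorRel-sym {just _}  {just _}  t≈u = ≈sym t≈u

    PredecessorRel-trans : ∀ {m m' m''} → PredecessorRel m m' → PredecessorRel m' m'' → PredecessorRel m m''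
    PredecessorRel-trans {nothing} {nothing} {nothing} _   _   = tt
    PredecessorRel-trans {just _}  {just _}  {just _}  t≈u u≈w = ≈trans t≈u u≈w

    Related-sym : ∀ σ {a b} → Related σ a b → Related σ b a
    Related-trans : ∀ σ {a b c} → Related σ a b → Related σ b c → Related σ a c
    Related-sym (base n) t≈u          = ≈sym t≈u
    Related-sym nt (t≈u , m~m')       = ≈sym t≈u , PredecessorRel-sym m~m'
    Related-sym lst t≈u               = ≈sym t≈u
    Related-sym (σ ⇒ ρ) (t≈u , f~g , f-β) =
      ≈sym t≈u ,
      (λ a b a~b → Related-sym ρ (f~g b a (Related-sym σ a~b))) ,
      λ a a~a → ≈trans (≈sym (Related⇒≈ ρ (f~g a a a~a))) (≈trans (f-β a a~a) (≈app t≈u ≈refl))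
    Related-trans (base n) t≈u u≈w                 = ≈trans t≈u u≈w
    Related-trans nt (t≈u , m~m') (u≈w , m'~m'')   = ≈trans t≈u u≈w , PredecessorRel-trans m~m' m'~m''
    Related-trans lst t≈u u≈w                      = ≈trans t≈u u≈w
    Related-trans (σ ⇒ ρ) (t≈u , f~g , f-β) (u≈w , g~h , _) =
      ≈trans t≈u u≈w ,
      (λ a b a~b → Related-trans ρ (f~g a b a~b) (g~h b b (Related-trans σ (Related-sym σ a~b) a~b))) ,
      f-β

    Related-reflˡ : ∀ σ {a b} → Related σ a b → Related σ a a
    Related-reflˡ σ a~b = Related-trans σ a~b (Related-sym σ a~b)

    reflect-Related : ∀ σ {t u : Tm Ω σ} → t ≈ u → Related σ (reflect σ t) (reflect σ u)
    reflect-Related (base n) t≈u = t≈u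
    reflect-Related nt t≈u       = t≈u , tt
    reflect-Related lst t≈u      = t≈u
    reflect-Related (σ ⇒ ρ) t≈u  =
      t≈u ,
      (λ a b a~b → reflect-Related ρ (≈app t≈u (Related⇒≈ σ a~b))) ,
      λ a _ → ≡⇒≈ (reify-reflect ρ _)

    Env : Ctx → Set
    Env Δ = ∀ {σ} → Δ ∋ σ → Val σ

    _∷ₑ_ : ∀ {Δ σ} → Val σ → Env Δ → Env (σ ∷ Δ)
    (a ∷ₑ ρ) here      = a
    (a ∷ₑ ρ) (there v) = ρ v

    reifyₑ : ∀ {Δ} → Env Δ → Sub Δ Ω
    reifyₑ ρ {σ} v = reify σ (ρ v)

    infix 4 _≋ₑ_
    _≋ₑ_ : ∀ {Δ} → Env Δ → Env Δ → Set
    ρ ≋ₑ ρ' = ∀ {σ} v → Related σ (ρ v) (ρ' v)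

    ∷ₑ-Related : ∀ {Δ σ} {ρ ρ' : Env Δ} {a b : Val σ} →
                 Related σ a b → ρ ≋ₑ ρ' → (a ∷ₑ ρ) ≋ₑ (b ∷ₑ ρ')
    ∷ₑ-Related a~b ρ≋ρ' here      = a~b
    ∷ₑ-Related a~b ρ≋ρ' (there v) = ρ≋ρ' v

    ≋ₑ⇒≈ₛ : ∀ {Δ} {ρ ρ' : Env Δ} → ρ ≋ₑ ρ' → reifyₑ ρ ≈ₛ reifyₑ ρ'
    ≋ₑ⇒≈ₛ ρ≋ρ' {σ} v = Related⇒≈ σ (ρ≋ρ' v)

    ≋ₑ-sym : ∀ {Δ} {ρ ρ' : Env Δ} → ρ ≋ₑ ρ' → ρ' ≋ₑ ρ
    ≋ₑ-sym ρ≋ρ' {σ} v = Related-sym σ (ρ≋ρ' v)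

    ≋ₑ-reflˡ : ∀ {Δ} {ρ ρ' : Env Δ} → ρ ≋ₑ ρ' → ρ ≋ₑ ρ
    ≋ₑ-reflˡ ρ≋ρ' {σ} v = Related-reflˡ σ (ρ≋ρ' v)

    evalConst : ∀ {σ} → Const σ → Val σ
    evalConst zC           = reflect nt (cst zC)
    evalConst sC           = cst sC , λ a → sT (proj₁ a) , just (proj₁ a)
    evalConst nilC         = reflect lst (cst nilC)
    evalConst consC        = reflect (τ ⇒ lst ⇒ lst) (cst consC)
    evalConst {σ} (ucon k) = reflect σ (cst (ucon k))

    reify-evalConst : ∀ {σ} (c : Const σ) → reify σ (evalConst c) ≡ cst c
    reify-evalConst zC           = refl
    reify-evalConst sC           = refl
    reify-evalConst nilC         = refl
    reify-evalConst consC        = refl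
    reify-evalConst {σ} (ucon k) = reify-reflect σ _

    evalConst-Related : ∀ {σ} (c : Const σ) → Related σ (evalConst c) (evalConst c)
    evalConst-Related zC           = reflect-Related nt ≈refl
    evalConst-Related sC           =
      ≈refl , (λ a b a~b → ≈app ≈refl (proj₁ a~b) , proj₁ a~b) , λ _ _ → ≈refl
    evalConst-Related nilC         = reflect-Related lst ≈refl
    evalConst-Related consC        = reflect-Related (τ ⇒ lst ⇒ lst) ≈refl
    evalConst-Related {σ} (ucon k) = reflect-Related σ ≈refl

    eval : ∀ {Δ σ} → Tm Δ σ → Env Δ → Val σ
    eval (var v)   ρ = ρ v
    eval (cst c)   ρ = evalConst c
    eval (lam t)   ρ = sub (reifyₑ ρ) (lam t) , λ a → eval t (a ∷ₑ ρ)
    eval (app t u) ρ = proj₂ (eval t ρ) (eval u ρ)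

    reifyₑ-∷ₑ-β : ∀ {Δ σ ρ₀} (t : Tm (σ ∷ Δ) ρ₀) (ρ : Env Δ) (a : Val σ) →
                  sub (reifyₑ (a ∷ₑ ρ)) t ≈ app (sub (reifyₑ ρ) (lam t)) (reify σ a)
    reifyₑ-∷ₑ-β t ρ a = ≈sym (≈trans (≈β (sub (exts (reifyₑ ρ)) t) _)
      (≡⇒≈ (trans (sub-sub _ _ t) (sub-cong sub1-exts t))))
      where
      sub1-exts : (λ {σ} v → sub (sub1 (reify _ a)) (exts (reifyₑ ρ) {σ} v)) ≗ᵥ reifyₑ (a ∷ₑ ρ)
      sub1-exts here      = refl
      sub1-exts (there v) = sub1-weaken _ (reifyₑ ρ v)

    eval-Related : ∀ {Δ σ} (t : Tm Δ σ) {ρ ρ' : Env Δ} → ρ ≋ₑ ρ' → Related σ (eval t ρ) (eval t ρ')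
    reify-eval : ∀ {Δ σ} (t : Tm Δ σ) {ρ : Env Δ} → ρ ≋ₑ ρ → reify σ (eval t ρ) ≈ sub (reifyₑ ρ) t

    reify-eval-lam : ∀ {Δ σ ρ₀} (t : Tm (σ ∷ Δ) ρ₀) {ρ : Env Δ} → ρ ≋ₑ ρ → ∀ a → Related σ a a →
                     reify ρ₀ (eval t (a ∷ₑ ρ)) ≈ app (sub (reifyₑ ρ) (lam t)) (reify σ a)
    reify-eval-lam t {ρ} ρ≋ρ a a~a = ≈trans (reify-eval t (∷ₑ-Related a~a ρ≋ρ)) (reifyₑ-∷ₑ-β t ρ a)

    eval-Related (var v)  ρ≋ρ' = ρ≋ρ' v
    eval-Related (cst c)  ρ≋ρ' = evalConst-Related c
    eval-Related (lam t)  ρ≋ρ' =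
      sub-resp-≈ₛ (≋ₑ⇒≈ₛ ρ≋ρ') (lam t) ,
      (λ a b a~b → eval-Related t (∷ₑ-Related a~b ρ≋ρ')) ,
      reify-eval-lam t (≋ₑ-reflˡ ρ≋ρ')
    eval-Related (app t u) ρ≋ρ' = proj₁ (proj₂ (eval-Related t ρ≋ρ')) _ _ (eval-Related u ρ≋ρ')
    reify-eval (var v)   ρ≋ρ = ≈refl
    reify-eval (cst c)   ρ≋ρ = ≡⇒≈ (reify-evalConst c)
    reify-eval (lam t)   ρ≋ρ = ≈refl
    reify-eval (app t u) {ρ} ρ≋ρ =
      ≈trans (proj₂ (proj₂ (eval-Related t ρ≋ρ)) (eval u ρ) (eval-Related u ρ≋ρ))
             (≈app (reify-eval t ρ≋ρ) (reify-eval u ρ≋ρ))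

    eval-ren : ∀ {Δ Δ' σ} (r : Ren Δ Δ') (t : Tm Δ σ) {ρ' : Env Δ'} {ρ : Env Δ} → ρ' ≋ₑ ρ' →
               (∀ {σ'} (v : Δ ∋ σ') → Related σ' (ρ' (r v)) (ρ v)) →
               Related σ (eval (ren r t) ρ') (eval t ρ)
    eval-ren r (var v)   ρ'≋ρ' r-ρ = r-ρ v
    eval-ren r (cst c)   ρ'≋ρ' r-ρ = evalConst-Related c
    eval-ren r (lam t) {ρ'} ρ'≋ρ' r-ρ =
      ≈trans (≡⇒≈ (sub-ren (reifyₑ ρ') r (lam t)))
             (sub-resp-≈ₛ (λ {σ'} v → Related⇒≈ σ' (r-ρ v)) (lam t)) ,
      (λ a b a~b → eval-ren (ext r) t (∷ₑ-Related (Related-reflˡ _ a~b) ρ'≋ρ')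
                     (λ { here → a~b ; (there v) → r-ρ v })) ,
      reify-eval-lam (ren (ext r) t) ρ'≋ρ'
    eval-ren r (app t u) ρ'≋ρ' r-ρ = proj₁ (proj₂ (eval-ren r t ρ'≋ρ' r-ρ)) _ _ (eval-ren r u ρ'≋ρ' r-ρ)

    eval-sub : ∀ {Δ Δ' σ} (s : Sub Δ Δ') (t : Tm Δ σ) {ρ' : Env Δ'} {ρ : Env Δ} → ρ' ≋ₑ ρ' →
               (∀ {σ'} (v : Δ ∋ σ') → Related σ' (eval (s v) ρ') (ρ v)) →
               Related σ (eval (sub s t) ρ') (eval t ρ)
    eval-sub s (var v)   ρ'≋ρ' s-ρ = s-ρ v
    eval-sub s (cst c)   ρ'≋ρ' s-ρ = evalConst-Related c
    eval-sub s (lam t) {ρ'} ρ'≋ρ' s-ρ =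
      ≈trans (≡⇒≈ (sub-sub (reifyₑ ρ') s (lam t)))
        (sub-resp-≈ₛ (λ {σ'} v → ≈trans (≈sym (reify-eval (s v) ρ'≋ρ')) (Related⇒≈ σ' (s-ρ v))) (lam t)) ,
      (λ a b a~b → let aρ'≋aρ' = ∷ₑ-Related (Related-reflˡ _ a~b) ρ'≋ρ' in
         eval-sub (exts s) t aρ'≋aρ'
           (λ { here → a~b
              ; (there {x = σ'} v) → Related-trans σ' (eval-ren there (s v) aρ'≋aρ' ρ'≋ρ') (s-ρ v) })) ,
      reify-eval-lam (sub (exts s) t) ρ'≋ρ'
    eval-sub s (app t u) ρ'≋ρ' s-ρ = proj₁ (proj₂ (eval-sub s t ρ'≋ρ' s-ρ)) _ _ (eval-sub s u ρ'≋ρ' s-ρ)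

    eval-resp-≈ : ∀ {Δ σ} {t u : Tm Δ σ} → t ≈ u →
                  {ρ ρ' : Env Δ} → ρ ≋ₑ ρ' → Related σ (eval t ρ) (eval u ρ')
    eval-resp-≈ {t = t} ≈refl ρ≋ρ'           = eval-Related t ρ≋ρ'
    eval-resp-≈ {σ = σ} (≈sym u≈t) ρ≋ρ'      = Related-sym σ (eval-resp-≈ u≈t (≋ₑ-sym ρ≋ρ'))
    eval-resp-≈ {σ = σ} (≈trans t≈u u≈w) ρ≋ρ' =
      Related-trans σ (eval-resp-≈ t≈u ρ≋ρ') (eval-resp-≈ u≈w (≋ₑ-reflˡ (≋ₑ-sym ρ≋ρ')))
    eval-resp-≈ (≈lam {t = t} t≈u) {ρ} {ρ'} ρ≋ρ' =
      ≈trans (sub-resp-≈ₛ (≋ₑ⇒≈ₛ ρ≋ρ') (lam t)) (sub-resp-≈ (reifyₑ ρ') (≈lam t≈u)) ,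
      (λ a b a~b → eval-resp-≈ t≈u (∷ₑ-Related a~b ρ≋ρ')) ,
      reify-eval-lam t (≋ₑ-reflˡ ρ≋ρ')
    eval-resp-≈ (≈app t≈t' u≈u') ρ≋ρ' =
      proj₁ (proj₂ (eval-resp-≈ t≈t' ρ≋ρ')) _ _ (eval-resp-≈ u≈u' ρ≋ρ')
    eval-resp-≈ {σ = σ} (≈β t u) ρ≋ρ' =
      Related-sym σ (eval-sub (sub1 u) t (≋ₑ-reflˡ (≋ₑ-sym ρ≋ρ'))
        (λ { here → eval-Related u (≋ₑ-sym ρ≋ρ') ; (there {x = σ'} v) → Related-sym σ' (ρ≋ρ' v) }))
    eval-resp-≈ {σ = σ ⇒ ρ₀} (≈η t) {ρ} {ρ'} ρ≋ρ' =
      ≈trans (reify-eval t (≋ₑ-reflˡ ρ≋ρ')) (≈trans (sub-resp-≈ₛ (≋ₑ⇒≈ₛ ρ≋ρ') t)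
        (≈trans (≈η (sub (reifyₑ ρ') t))
          (≡⇒≈ (cong (λ t' → lam (app t' (var here))) (sym (sub-exts-weaken (reifyₑ ρ') t)))))) ,
      (λ a b a~b → proj₁ (proj₂ (Related-sym (σ ⇒ ρ₀)
          (eval-ren there t (∷ₑ-Related (Related-reflˡ σ (Related-sym σ a~b)) (≋ₑ-reflˡ (≋ₑ-sym ρ≋ρ')))
             (λ {σ'} w → Related-sym σ' (ρ≋ρ' w))))) a b a~b) ,
      proj₂ (proj₂ (eval-Related t (≋ₑ-reflˡ ρ≋ρ')))

    idₑ : Env Ω
    idₑ {σ} v = reflect σ (var v)

    idₑ-Related : idₑ ≋ₑ idₑ
    idₑ-Related {σ} v = reflect-Related σ ≈refl

    reify-eval-idₑ : ∀ {σ} (t : Tm Ω σ) → reify σ (eval t idₑ) ≈ t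
    reify-eval-idₑ t = ≈trans (reify-eval t idₑ-Related)
      (≡⇒≈ (trans (sub-cong (λ {σ'} v → reify-reflect σ' (var v)) t) (sub-id t)))

  sT-injective : ∀ {Ω} {t u : Tm Ω nt} → sT t ≈ sT u → t ≈ u
  sT-injective {Ω} {t} {u} st≈su =
    ≈trans (≈sym (reify-eval-idₑ t)) (≈trans (proj₂ (eval-resp-≈ st≈su idₑ-Related)) (reify-eval-idₑ u))
    where open Model Ω

  zT≉sT : ∀ {Ω} {t : Tm Ω nt} → ¬ (zT ≈ sT t)
  zT≉sT {Ω} z≈st = proj₂ (eval-resp-≈ z≈st idₑ-Related)
    where open Model Ω

module Derivations (τ : Ty) (Sig : List Ty) (PSig : List (List Ty)) where
  open FOλ τ Sig PSig
  open Substitution τ Sig PSig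
  open Conversion τ Sig PSig

  allUnifiers : ∀ {Δ Ξ} (A : Fm Δ) (H : Fm Ξ) → CSU A H
  mem      (allUnifiers A H) Δ' θ θ' = Unifies A H θ θ'
  sound    (allUnifiers A H) θ θ' θθ'-unify = θθ'-unify
  complete (allUnifiers A H) σ σ' σσ'-unify =
    _ , σ , σ' , σσ'-unify , var ,
    (λ v → ≡⇒≈ (sym (sub-id (σ v)))) , (λ v → ≡⇒≈ (sym (sub-id (σ' v))))

  module _ {Leaf : (Δ : Ctx) → List (Fm Δ) → Fm Δ → Set} where

    DefLPremises : ∀ {Δ} (p : Pred) → Args Δ (arity p) → List (Fm Δ) → Fm Δ → Set₁
    DefLPremises {Δ} p us Γ C =
      ∀ c {Δ'} (θ : Sub Δ Δ') (θ' : Sub (cctx c) Δ') → Unifies (atom p us) (chead c) θ θ' →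
      Deriv Leaf Δ' (subF θ' (cbody c) ∷ map (subF θ) Γ) (subF θ C)

    defL-allUnifiers : ∀ {Δ p us Γ C} → Defined p → DefLPremises {Δ} p us Γ C →
                       Deriv Leaf Δ (atom p us ∷ Γ) C
    defL-allUnifiers {p = p} {us} p-defined premises = defL p p-defined us (λ c → allUnifiers _ _) premises

    exchange : ∀ {Δ A A' Γ C} → Deriv Leaf Δ (A ∷ A' ∷ Γ) C → Deriv Leaf Δ (A' ∷ A ∷ Γ) C
    exchange = exch (↭-swap _ _ ↭-refl)

    convˡ : ∀ {Δ A A' Γ C} → A ≈F A' → Deriv Leaf Δ (A ∷ Γ) C → Deriv Leaf Δ (A' ∷ Γ) C
    convˡ {Γ = Γ} {C} A≈A' = conv (∷≈ A≈A' (≈L-refl Γ)) (≈F-refl C)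

    convʳ : ∀ {Δ Γ C C'} → C ≈F C' → Deriv Leaf Δ Γ C → Deriv Leaf Δ Γ C'
    convʳ {Γ = Γ} = conv (≈L-refl Γ)

    identity : ∀ {Δ} (A : Fm Δ) (Γ : List (Fm Δ)) → Deriv Leaf Δ (A ∷ Γ) A
    identity (atom p ts) Γ = init p ts
    identity ⊥′ Γ          = ⊥L
    identity ⊤′ Γ          = ⊤R
    identity (A ∧ A') Γ    = ∧R (∧L₁ (identity A Γ)) (∧L₂ (identity A' Γ))
    identity (A ∨ A') Γ    = ∨L (∨R₁ (identity A Γ)) (∨R₂ (identity A' Γ))
    identity (A ⊃ A') Γ    = ⊃R (exchange (⊃L (identity A Γ) (identity A' (A ∷ Γ))))
    identity (all σ A) Γ   = ∀R (∀L (var here) (convˡ (≈F-sym (≡⇒≈F (sub1-var-renF-ext A))) (identity A _)))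
    identity (ex σ A) Γ    = ∃L (∃R (var here) (convʳ (≈F-sym (≡⇒≈F (sub1-var-renF-ext A))) (identity A _)))

    identity≈ : ∀ {Δ A A'} {Γ : List (Fm Δ)} → A ≈F A' → Deriv Leaf Δ (A ∷ Γ) A'
    identity≈ {A = A} A≈A' = convʳ A≈A' (identity A _)

    weakenʳ≈ : ∀ {Δ A A'} {Γ₁ Γ₂ : List (Fm Δ)} → A ≈F A' →
               Deriv Leaf Δ Γ₁ A → Deriv Leaf Δ (Γ₁ ++ Γ₂) A'
    weakenʳ≈ A≈A' ⊢A = cut ⊢A (identity≈ A≈A')

module ListInduction (τ : Ty) (Sig : List Ty) (PSig : List (List Ty))
                     {Δ : Ctx} (C : FOλ.Fm τ Sig PSig Δ) (B : FOλ.Fm τ Sig PSig (lst ∷ Δ))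
                     (L : FOλ.Tm τ Sig PSig Δ lst) (Γ : List (FOλ.Fm τ Sig PSig Δ)) where
  open FOλ τ Sig PSig
  open Substitution τ Sig PSig
  open Conversion τ Sig PSig
  open ConversionModel τ Sig PSig using (sT-injective; zT≉sT)
  open Derivations τ Sig PSig

  premises : List Seq
  premises = seq Δ [] (B ⟪ nilT ⟫)
           ∷ seq (τ ∷ lst ∷ Δ) (subF (liftSub2 lV) B ∷ []) (subF (liftSub2 (xV :: lV)) B)
           ∷ seq Δ (B ⟪ L ⟫ ∷ Γ) C
           ∷ []

  infix 3 _⟶_
  _⟶_ : ∀ {Ξ} → List (Fm Ξ) → Fm Ξ → Set₁
  _⟶_ {Ξ} = Deriv (Inst premises) Ξ

  B[_]_ : ∀ {Ξ} → Sub Δ Ξ → Tm Ξ lst → Fm Ξ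
  B[ η ] l = subF (l ∷ₛ η) B

  B[]-sub : ∀ {Ξ Ω} (s : Sub Ξ Ω) (η : Sub Δ Ξ) (l : Tm Ξ lst) →
            subF s (B[ η ] l) ≡ B[ (λ v → sub s (η v)) ] (sub s l)
  B[]-sub s η l = subF-subF s (l ∷ₛ η) (λ { here → refl ; (there v) → refl }) B

  B[]-sub² : ∀ {Ξ₁ Ξ₂ Ξ₃} (s : Sub Ξ₂ Ξ₃) (s' : Sub Ξ₁ Ξ₂) (η : Sub Δ Ξ₁) (l : Tm Ξ₁ lst) →
             subF s (subF s' (B[ η ] l)) ≡ B[ (λ v → sub s (sub s' (η v))) ] (sub s (sub s' l))
  B[]-sub² s s' η l = trans (cong (subF s) (B[]-sub s' η l)) (B[]-sub s _ _)

  B[]-ren : ∀ {Ξ Ω} (r : Ren Ξ Ω) (η : Sub Δ Ξ) (l : Tm Ξ lst) →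
            renF r (B[ η ] l) ≡ B[ (λ v → ren r (η v)) ] (ren r l)
  B[]-ren r η l = trans (renF-sub r (l ∷ₛ η) B) (subF-cong (λ { here → refl ; (there v) → refl }) B)

  B[]-resp-≈ : ∀ {Ξ} {η η' : Sub Δ Ξ} {l l' : Tm Ξ lst} →
               η ≈ₛ η' → l ≈ l' → B[ η ] l ≈F B[ η' ] l'
  B[]-resp-≈ η≈η' l≈l' = subF-resp-≈ₛ (λ { here → l≈l' ; (there v) → η≈η' v }) B

  nil-premise : ∀ {Ξ} (η : Sub Δ Ξ) → [] ⟶ B[ η ] nilT
  nil-premise η =
    leaf (inst here η refl (sym (subF-subF η (sub1 nilT) (λ { here → refl ; (there v) → refl }) B)))

  cons-premise : ∀ {Ξ} (η : Sub Δ Ξ) (x : Tm Ξ τ) (l : Tm Ξ lst) → B[ η ] l ∷ [] ⟶ B[ η ] (x :: l)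
  cons-premise η x l = leaf (inst (there here) (x ∷ₛ l ∷ₛ η)
    (cong (_∷ []) (sym (subF-subF _ (liftSub2 lV) (λ { here → refl ; (there v) → refl }) B)))
    (sym (subF-subF _ (liftSub2 (xV :: lV)) (λ { here → refl ; (there v) → refl }) B)))

  conclusion-premise : ∀ {Ξ} (η : Sub Δ Ξ) {l Γ' C'} → l ≈ sub η L →
                       Γ' ≡ map (subF η) Γ → C' ≡ subF η C → B[ η ] l ∷ Γ' ⟶ C'
  conclusion-premise η l≈ηL Γ'≡ C'≡ =
    convˡ (B[]-resp-≈ (λ _ → ≈refl) (≈sym l≈ηL))
      (leaf (inst (there (there here)) η
        (cong₂ _∷_ (sym (subF-subF η (sub1 L) (λ { here → refl ; (there v) → refl }) B)) Γ'≡) C'≡))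

  Nat : ∀ {Ξ} → Tm Ξ nt → Fm Ξ
  Nat I = atom nat (I ∷ₐ []ₐ)

  Length : ∀ {Ξ} → Tm Ξ lst → Tm Ξ nt → Fm Ξ
  Length l I = atom length (l ∷ₐ I ∷ₐ []ₐ)

  weaken₂ : ∀ {Ξ ρ ρ'} → Sub Δ Ξ → Sub Δ (ρ ∷ ρ' ∷ Ξ)
  weaken₂ η v = ren (λ w → there (there w)) (η v)

  AllOfLength : ∀ {Ξ} → Sub Δ Ξ → Fm (nt ∷ Ξ)
  AllOfLength η = all lst (Length (var here) (var (there here)) ⊃ B[ weaken₂ η ] var here)

  allOfLength-zero : ∀ {Ξ} (η : Sub Δ Ξ) → [] ⟶ AllOfLength η ⟪ zT ⟫
  allOfLength-zero η = cut (nil-premise η) (∀R (⊃R (defL-allUnifiers dlength cases)))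
    where
    cases : DefLPremises length (var here ∷ₐ zT ∷ₐ []ₐ) (renF there (B[ η ] nilT) ∷ [])
                         (subF (exts (sub1 zT)) (B[ weaken₂ η ] var here))
    cases cLenNil θ θ' (atom≈ _ (∷≈ θl≈nil _)) = exchange (identity≈ (begin
      subF θ (renF there (B[ η ] nilT))
        ≡⟨ trans (cong (subF θ) (B[]-ren there η nilT)) (B[]-sub θ _ nilT) ⟩
      B[ (λ v → sub θ (ren there (η v))) ] nilT
        ≈⟨ B[]-resp-≈ (λ v → ≡⇒≈ (trans (sub-ren θ there (η v)) (sym (sub-sub-ren θ _ _ (η v)))))
                      (≈sym θl≈nil) ⟩
      B[ (λ v → sub θ (sub (exts (sub1 zT)) (weaken₂ η v))) ] θ here
        ≡⟨ B[]-sub² θ (exts (sub1 zT)) (weaken₂ η) (var here) ⟨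
      subF θ (subF (exts (sub1 zT)) (B[ weaken₂ η ] var here)) ∎))
      where open SetoidReasoning (≈F-setoid _)
    cases cLenCons   θ θ' (atom≈ _ (∷≈ _ (∷≈ z≈sI []≈))) = ⊥-elim (zT≉sT z≈sI)
    cases cList      θ θ' ()
    cases cElemHere  θ θ' ()
    cases cElemThere θ θ' ()
    cases cSplitNil  θ θ' ()
    cases cSplitL    θ θ' ()
    cases cSplitR    θ θ' ()
    cases cPermNil   θ θ' ()
    cases cPermCons  θ θ' ()

  allOfLength-suc : ∀ {Ξ} (η : Sub Δ Ξ) → AllOfLength η ∷ [] ⟶ subF sucSub (AllOfLength η)
  allOfLength-suc η = ∀R (⊃R (defL-allUnifiers dlength cases))
    where
    cases : DefLPremises length (var here ∷ₐ sT (var (there here)) ∷ₐ []ₐ)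
                         (renF there (AllOfLength η) ∷ [])
                         (subF (exts sucSub) (B[ weaken₂ η ] var here))
    cases cLenNil θ θ' (atom≈ _ (∷≈ _ (∷≈ sJ≈z []≈))) = ⊥-elim (zT≉sT (≈sym sJ≈z))
    cases cLenCons θ θ' (atom≈ _ (∷≈ θl≈x∷l (∷≈ sJ≈sI []≈))) =
      exchange (∀L l (⊃L (convʳ (atom≈ length (∷≈ ≈refl (∷≈ I≈J []≈))) (init length _))
                         (convˡ B-at-l (weakenʳ≈ B-at-x∷l (cons-premise η' x l)))))
      where
      open SetoidReasoning (≈F-setoid _)
      x = θ' here
      l = θ' (there here)
      I = θ' (there (there here))
      J = θ (there here)
      η' : Sub Δ _
      η' v = sub (λ w → θ (there (there w))) (η v)
      I≈J : I ≈ sub (sub1 l) (ren there J)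
      I≈J = ≈trans (≈sym (sT-injective sJ≈sI)) (≡⇒≈ (sym (sub1-weaken l J)))
      B-at-l : B[ η' ] l ≈F subF (sub1 l) (subF (exts θ) (renF (ext there) (B[ weaken₂ η ] var here)))
      B-at-l = begin
        B[ η' ] l
          ≈⟨ B[]-resp-≈ (λ v → ≡⇒≈ (sym (restrict-η v))) ≈refl ⟩
        B[ (λ v → sub (sub1 l) (sub (exts θ) (ren (ext there) (weaken₂ η v)))) ] l
          ≡⟨ trans (cong (λ F → subF (sub1 l) (subF (exts θ) F)) (B[]-ren (ext there) _ (var here)))
                   (B[]-sub² (sub1 l) (exts θ) _ (var here)) ⟨
        subF (sub1 l) (subF (exts θ) (renF (ext there) (B[ weaken₂ η ] var here))) ∎
        where
        restrict-η : ∀ {σ} (v : Δ ∋ σ) →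
                     sub (sub1 l) (sub (exts θ) (ren (ext there) (weaken₂ η v))) ≡ η' v
        restrict-η v = trans (cong (λ t → sub (sub1 l) (sub (exts θ) t)) (ren-ren (ext there) _ (η v)))
          (trans (sub-sub-ren (sub1 l) (exts θ) _ (η v))
                 (sub-cong (λ w → sub1-weaken l (θ (there (there w)))) (η v)))
      B-at-x∷l : B[ η' ] (x :: l) ≈F subF θ (subF (exts sucSub) (B[ weaken₂ η ] var here))
      B-at-x∷l = begin
        B[ η' ] (x :: l)
          ≈⟨ B[]-resp-≈ (λ v → ≡⇒≈ (sym (sub-sub-ren θ (exts sucSub) _ (η v)))) (≈sym θl≈x∷l) ⟩
        B[ (λ v → sub θ (sub (exts sucSub) (weaken₂ η v))) ] θ here
          ≡⟨ B[]-sub² θ (exts sucSub) (weaken₂ η) (var here) ⟨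
        subF θ (subF (exts sucSub) (B[ weaken₂ η ] var here)) ∎
    cases cList      θ θ' ()
    cases cElemHere  θ θ' ()
    cases cElemThere θ θ' ()
    cases cSplitNil  θ θ' ()
    cases cSplitL    θ θ' ()
    cases cSplitR    θ θ' ()
    cases cPermNil   θ θ' ()
    cases cPermCons  θ θ' ()

  allOfLength-elim : ∀ {Ξ} (η : Sub Δ Ξ) (I : Tm Ξ nt) (l : Tm Ξ lst) →
                     AllOfLength η ⟪ I ⟫ ∷ (Nat I ∧ Length l I) ∷ [] ⟶ B[ η ] l
  allOfLength-elim η I l =
    ∀L l (⊃L (∧L₂ (convʳ (atom≈ length (∷≈ ≈refl (∷≈ I≈I []≈))) (init length _))) (identity≈ B-at-l))
    where
    open SetoidReasoning (≈F-setoid _)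
    I≈I : I ≈ sub (sub1 l) (ren there I)
    I≈I = ≡⇒≈ (sym (sub1-weaken l I))
    B-at-l : subF (sub1 l) (subF (exts (sub1 I)) (B[ weaken₂ η ] var here)) ≈F B[ η ] l
    B-at-l = begin
      subF (sub1 l) (subF (exts (sub1 I)) (B[ weaken₂ η ] var here))
        ≡⟨ B[]-sub² (sub1 l) (exts (sub1 I)) (weaken₂ η) (var here) ⟩
      B[ (λ v → sub (sub1 l) (sub (exts (sub1 I)) (weaken₂ η v))) ] l
        ≈⟨ B[]-resp-≈ (λ v → ≡⇒≈ (trans (sub-sub-ren _ _ _ (η v)) (sub-id (η v)))) ≈refl ⟩
      B[ η ] l ∎

  nat∧length⇒B : ∀ {Ξ} (η : Sub Δ Ξ) (I : Tm Ξ nt) (l : Tm Ξ lst) →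
                 (Nat I ∧ Length l I) ∷ [] ⟶ B[ η ] l
  nat∧length⇒B η I l =
    contr (∧L₁ (natL (AllOfLength η) I
                     (allOfLength-zero η) (allOfLength-suc η) (allOfLength-elim η I l)))

proposition2p5 : (τ : Ty) (Sig : List Ty) (PSig : List (List Ty)) →
    let open FOλ τ Sig PSig in
    ∀ {Δ : Ctx} (C : Fm Δ) (B : Fm (lst ∷ Δ)) (L : Tm Δ lst) (Γ : List (Fm Δ)) →
    DerivableFrom
      ( seq Δ [] (B ⟪ nilT ⟫)
      ∷ seq (τ ∷ lst ∷ Δ) (subF (liftSub2 lV) B ∷ []) (subF (liftSub2 (xV :: lV)) B)
      ∷ seq Δ (B ⟪ L ⟫ ∷ Γ) C
      ∷ [] )
      (seq Δ (atom list (L ∷ₐ []ₐ) ∷ Γ) C)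
proposition2p5 τ Sig PSig {Δ} C B L Γ = defL-allUnifiers dlist unfold-list
  where
  open FOλ τ Sig PSig
  open Substitution τ Sig PSig
  open Conversion τ Sig PSig
  open Derivations τ Sig PSig
  open ListInduction τ Sig PSig C B L Γ

  unfold-list : DefLPremises list (L ∷ₐ []ₐ) Γ C
  unfold-list cList θ θ' (atom≈ _ (∷≈ θL≈l []≈)) =
    ∃L (cut (nat∧length⇒B η (var here) (ren there (θ' here)))
            (conclusion-premise η (≈trans (ren-resp-≈ there (≈sym θL≈l)) (≡⇒≈ (ren-sub there θ L)))
                                (map-renF-subF there θ Γ) (renF-sub there θ C)))
    where
    η : Sub Δ _
    η v = ren there (θ v)
  unfold-list cLenNil    θ θ' ()
  unfold-list cLenCons   θ θ' ()
  unfold-list cElemHere  θ θ' ()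
  unfold-list cElemThere θ θ' ()
  unfold-list cSplitNil  θ θ' ()
  unfold-list cSplitL    θ θ' ()
  unfold-list cSplitR    θ θ' ()
  unfold-list cPermNil   θ θ' ()
  unfold-list cPermCons  θ θ' ()
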